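{- Let $\mathbf{Q}$ be a QB-algebra. Then every cloud $x/\chi$ ($x\in Q$) of $\mathbf{Q}$ contains exactly one regular element.
   Context: A quasi-lattice is an algebra $\langle L;\vee,\wedge\rangle$ such that for all $x,y,z$: $\vee,\wedge$ are commutative and associative; $x\vee(x\wedge y)=x\vee x$ and $x\wedge(x\vee y)=x\wedge x$; $x\vee(y\vee y)=x\vee y$ and $x\wedge(y\wedge y)=x\wedge y$; $x\vee x=x\wedge x$; distributive if both distributive laws hold. A QB-algebra is an algebra $\langle Q;\vee,\wedge,{}^{*},0,1\rangle$ of type $\langle 2,2,1,0,0\rangle$ such that $\langle Q;\vee,\wedge\rangle$ is a distributive quasi-lattice and for all $x$: $x\vee 1=1$, $x\wedge 0=0$, $x\vee x^{*}=1$, $x\wedge x^{*}=0$, $(x\wedge x)^{*}=x^{*}\vee x^{*}$, $x^{**}=x$. An element $x$ is regular if $x\vee x=x$. Define $x\le y$ iff $x\vee y=y\vee y$, and $\chi=\{\langle x,y\rangle\in Q^2: x\le y\text{ and }y\le x\}$ (equivalently $x\vee x=y\vee y$). For $x\in Q$, the set $x/\chi=\{y\in Q:\langle x,y\rangle\in\chi\}$ is called a cloud. -}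

module Defs where

open import Level using (Level; suc)
open import Relation.Binary.PropositionalEquality using (_≡_)

record QBAlgebra (a : Level) : Set (suc a) where
  infixr 6 _∨_
  infixr 7 _∧_
  field
    Carrier : Set a
    _∨_ : Carrier → Carrier → Carrier
    _∧_ : Carrier → Carrier → Carrier
    _* : Carrier → Carrier
    𝟘 : Carrier
    𝟙 : Carrier
    ∨-comm : ∀ x y → x ∨ y ≡ y ∨ x
    ∧-comm : ∀ x y → x ∧ y ≡ y ∧ x
    ∨-assoc : ∀ x y z → (x ∨ y) ∨ z ≡ x ∨ (y ∨ z)
    ∧-assoc : ∀ x y z → (x ∧ y) ∧ z ≡ x ∧ (y ∧ z)
    ∨-absorb : ∀ x y → x ∨ (x ∧ y) ≡ x ∨ x
    ∧-absorb : ∀ x y → x ∧ (x ∨ y) ≡ x ∧ x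
    ∨-idem-r : ∀ x y → x ∨ (y ∨ y) ≡ x ∨ y
    ∧-idem-r : ∀ x y → x ∧ (y ∧ y) ≡ x ∧ y
    ∨∧-same : ∀ x → x ∨ x ≡ x ∧ x
    ∧-distrib-∨ : ∀ x y z → x ∧ (y ∨ z) ≡ (x ∧ y) ∨ (x ∧ z)
    ∨-distrib-∧ : ∀ x y z → x ∨ (y ∧ z) ≡ (x ∨ y) ∧ (x ∨ z)
    ∨-𝟙 : ∀ x → x ∨ 𝟙 ≡ 𝟙
    ∧-𝟘 : ∀ x → x ∧ 𝟘 ≡ 𝟘
    ∨-compl : ∀ x → x ∨ (x *) ≡ 𝟙
    ∧-compl : ∀ x → x ∧ (x *) ≡ 𝟘
    *-∧∧ : ∀ x → (x ∧ x) * ≡ (x *) ∨ (x *)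
    *-invol : ∀ x → (x *) * ≡ x

  Regular : Carrier → Set a
  Regular x = x ∨ x ≡ x

  _≤_ : Carrier → Carrier → Set a
  x ≤ y = x ∨ y ≡ y ∨ y

  χ : Carrier → Carrier → Set a
  χ x y = (x ≤ y) × (y ≤ x)
    where open import Data.Product using (_×_)

  _∈Cloud_ : Carrier → Carrier → Set a
  y ∈Cloud x = χ x y

module Submission where

open import Defs
open import Data.Product using (Σ; _×_; _,_)
open import Relation.Binary.PropositionalEquality using (_≡_; sym; trans; module ≡-Reasoning)
open import Level using (Level)

-- Idea: x ∨ x is regular and lies in the cloud of x, and two elements are
-- χ-related exactly when they have the same square y ∨ y; a regular s equals
-- its square, so a regular s in the cloud of x is forced to be x ∨ x.

module QBAlgebraProperties {a : Level} (Q : QBAlgebra a) where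
  open QBAlgebra Q
  open ≡-Reasoning

  ∨-self-absorbʳ : ∀ x → (x ∨ x) ∨ x ≡ x ∨ x
  ∨-self-absorbʳ x = trans (∨-assoc x x x) (∨-idem-r x x)

  ∨-self-regular : ∀ x → Regular (x ∨ x)
  ∨-self-regular x = trans (∨-idem-r (x ∨ x) x) (∨-self-absorbʳ x)

  ∨-self-∈Cloud : ∀ x → (x ∨ x) ∈Cloud x
  ∨-self-∈Cloud x = x≤xx , ∨-self-absorbʳ x
    where
    x≤xx : x ≤ (x ∨ x)
    x≤xx = trans (∨-idem-r x x) (sym (∨-self-regular x))

  χ⇒∨-self-≡ : ∀ {x y} → χ x y → x ∨ x ≡ y ∨ y
  χ⇒∨-self-≡ {x} {y} (x≤y , y≤x) = begin
    x ∨ x  ≡⟨ sym y≤x ⟩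
    y ∨ x  ≡⟨ ∨-comm y x ⟩
    x ∨ y  ≡⟨ x≤y ⟩
    y ∨ y  ∎

  regular-∈Cloud-unique : ∀ {x s} → s ∈Cloud x → Regular s → s ≡ x ∨ x
  regular-∈Cloud-unique s∈x s-reg = trans (sym s-reg) (sym (χ⇒∨-self-≡ s∈x))

lemma3p1 : {a : Level} (Q : QBAlgebra a) → let open QBAlgebra Q in
    ∀ x → Σ Carrier (λ r → (r ∈Cloud x) × Regular r
    × (∀ s → s ∈Cloud x → Regular s → s ≡ r))
lemma3p1 Q x =
  x ∨ x , ∨-self-∈Cloud x , ∨-self-regular x , λ _ → regular-∈Cloud-unique
  where
  open QBAlgebra Q
  open QBAlgebraProperties Q
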